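{- Every Lucasian GNS is $\mathbf P$-Green, where $\mathbf P=\bigcup_{p\text{ prime}}p^{\mathbf N}$.
   Context: A GNS over $D$ is a function $s\colon\mathbf N\to D$ with $s(0)=0$, $s(n)$ a non-zero-divisor for $n>0$, and $s(n-k)\mid s(n)-s(k)$ for $n>k>0$. It is Lucasian if $s(a+b)\equiv s(a)+s(b)\bmod s(a)s(b)$ for all $a,b$. For $\mathcal F\subset\mathbf N$ stable under division, $s$ is $\mathcal F$-Green if for all $m\in\mathcal F$ and all positive $a,b\mid m$, with $g=\gcd(a,b)$, $\ell=\operatorname{lcm}(a,b)$, one has $s(m)\equiv\frac m\ell\frac{s(a)s(b)}{s(g)}\bmod s(a)s(b)$. -}

module Defs where

open import Level using (_⊔_)
open import Algebra.Bundles using (CommutativeRing; Semiring)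
open import Data.Nat as ℕ using (ℕ; zero; suc; _∸_)
open import Data.Nat.Divisibility as ℕD using ()
open import Data.Nat.GCD using (gcd)
open import Data.Nat.LCM using (lcm)
open import Data.Nat.Primality using (Prime)
open import Data.Product using (Σ; ∃; _×_)
open import Relation.Binary.PropositionalEquality using (_≡_)

module _ {c ℓ} (R : CommutativeRing c ℓ) where
  open CommutativeRing R
  open import Algebra.Definitions.RawSemiring (Semiring.rawSemiring semiring)
    using (_∣_) renaming (_×_ to _·ℕ_)

  _≡_mod_ : Carrier → Carrier → Carrier → Set (c ⊔ ℓ)
  x ≡ y mod m = m ∣ (x - y)

  NonZeroDivisor : Carrier → Set (c ⊔ ℓ)
  NonZeroDivisor r = ∀ x → r * x ≈ 0# → x ≈ 0#

  record IsGNS (s : ℕ → Carrier) : Set (c ⊔ ℓ) where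
    field
      zero-at-0 : s 0 ≈ 0#
      nzd       : ∀ n → 0 ℕ.< n → NonZeroDivisor (s n)
      div       : ∀ n k → 0 ℕ.< k → k ℕ.< n → s (n ∸ k) ∣ (s n - s k)

  IsLucasian : (ℕ → Carrier) → Set (c ⊔ ℓ)
  IsLucasian s = ∀ a b → s (a ℕ.+ b) ≡ s a + s b mod (s a * s b)

  -- F-Green.  The quotient s(a)s(b)/s(g) is written as any Q with
  -- s(a)s(b) ≈ s(g) * Q (unique since s(g) is a non-zero-divisor), and
  -- m/ℓ as any k with m ≡ k * lcm a b.
  IsGreen : (ℕ → Set) → (ℕ → Carrier) → Set (c ⊔ ℓ)
  IsGreen F s = ∀ m → F m → ∀ a b → 0 ℕ.< a → 0 ℕ.< b → a ℕD.∣ m → b ℕD.∣ m →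
    ∀ Q → s a * s b ≈ s (gcd a b) * Q →
    ∀ k → m ≡ k ℕ.* lcm a b →
    s m ≡ k ·ℕ Q mod (s a * s b)

-- 𝐏 = ⋃_{p prime} p^ℕ  (includes p^0 = 1)
PrimePower : ℕ → Set
PrimePower m = Σ ℕ λ p → Σ ℕ λ e → Prime p × m ≡ p ℕ.^ e

-- The divisors of a prime power form a chain, so it suffices to treat a ∣ b,
-- where gcd a b = a, lcm a b = b and the quotient Q is s b.  Iterating the Lucas
-- congruence s (b + t b) ≡ s b + s (t b) mod s(b) s(t b) shows both that
-- s b ∣ s (t b) and that s (k b) ≡ k s(b) mod s(b)², and s(a) s(b) ∣ s(b)²
-- because s a ∣ s b.
module Submission where

open import Defs
open import Algebra.Bundles using (CommutativeRing; Semiring)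
open import Level using (_⊔_)
open import Data.Nat as ℕ using (ℕ; zero; suc; _^_; _≤_; z≤n; s≤s)
import Data.Nat.Properties as ℕ
open import Data.Nat.Divisibility as ℕD using (divides; _∣?_)
open import Data.Nat.GCD using (gcd; gcd[m,n]∣m; gcd-greatest; gcd-comm)
open import Data.Nat.LCM using (lcm; lcm-least; n∣lcm[m,n]; lcm-comm)
open import Data.Nat.Primality using (Prime; prime⇒irreducible; prime⇒nonZero)
open import Data.Nat.Coprimality using (Coprime; coprime-divisor)
open import Data.Product using (∃; _,_)
open import Data.Sum using (_⊎_; inj₁; inj₂; [_,_]′)
open import Function using (_∘_)
open import Relation.Nullary using (yes; no; contradiction)
open import Relation.Binary.PropositionalEquality as P using (_≡_)

p^i∣p^j : ∀ p {i j} → i ≤ j → p ^ i ℕD.∣ p ^ j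
p^i∣p^j p {j = j} z≤n     = ℕD.1∣ (p ^ j)
p^i∣p^j p         (s≤s h) = ℕD.*-pres-∣ (ℕD.∣-refl {p}) (p^i∣p^j p h)

∣p^e⇒≡p^i : ∀ {p} → Prime p → ∀ e {d} → d ℕD.∣ p ^ e → ∃ λ i → d ≡ p ^ i
∣p^e⇒≡p^i p-prime zero    d∣1 = 0 , ℕD.∣1⇒≡1 d∣1
∣p^e⇒≡p^i {p} p-prime (suc e) {d} d∣p^1+e with p ∣? d
... | yes (divides q P.refl) =
  let q∣p^e = ℕD.*-cancelʳ-∣ {q} {p ^ e} p {{prime⇒nonZero p-prime}}
                (P.subst (q ℕ.* p ℕD.∣_) (ℕ.*-comm p (p ^ e)) d∣p^1+e)
      (i , q≡p^i) = ∣p^e⇒≡p^i p-prime e q∣p^e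
  in suc i , P.trans (P.cong (ℕ._* p) q≡p^i) (ℕ.*-comm (p ^ i) p)
... | no p∤d = ∣p^e⇒≡p^i p-prime e (coprime-divisor d⊥p d∣p^1+e)
  where
  d⊥p : Coprime d p
  d⊥p (x∣d , x∣p) with prime⇒irreducible p-prime x∣p
  ... | inj₁ x≡1   = x≡1
  ... | inj₂ P.refl = contradiction x∣d p∤d

∣p^e-total : ∀ {p e a b} → Prime p → a ℕD.∣ p ^ e → b ℕD.∣ p ^ e →
             a ℕD.∣ b ⊎ b ℕD.∣ a
∣p^e-total {p} {e} p-prime a∣p^e b∣p^e
  with ∣p^e⇒≡p^i p-prime e a∣p^e | ∣p^e⇒≡p^i p-prime e b∣p^e
... | i , P.refl | j , P.refl with ℕ.≤-total i j
... | inj₁ i≤j = inj₁ (p^i∣p^j p i≤j)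
... | inj₂ j≤i = inj₂ (p^i∣p^j p j≤i)

m∣n⇒gcd[m,n]≡m : ∀ {m n} → m ℕD.∣ n → gcd m n ≡ m
m∣n⇒gcd[m,n]≡m {m} {n} m∣n = ℕD.∣-antisym (gcd[m,n]∣m m n) (gcd-greatest ℕD.∣-refl m∣n)

m∣n⇒lcm[m,n]≡n : ∀ {m n} → m ℕD.∣ n → lcm m n ≡ n
m∣n⇒lcm[m,n]≡n {m} {n} m∣n = ℕD.∣-antisym (lcm-least m∣n ℕD.∣-refl) (n∣lcm[m,n] m n)

module Congruence {c ℓ} (R : CommutativeRing c ℓ) where
  open CommutativeRing R
  open import Algebra.Definitions.RawSemiring (Semiring.rawSemiring semiring) using (_∣_)
  open import Algebra.Definitions.RawMagma *-rawMagma using (_,_)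
  open import Algebra.Properties.Semiring.Divisibility semiring using (∣ʳ-trans)
  open import Relation.Binary.Reasoning.Setoid setoid

  ≡mod⇒≈ : ∀ {x y m} → _≡_mod_ R x y m → ∃ λ q → x ≈ y + q * m
  ≡mod⇒≈ {x} {y} {m} (q , qm≈x-y) = q , sym (begin
    y + q * m        ≈⟨ +-congˡ qm≈x-y ⟩
    y + (x - y)      ≈⟨ +-comm y _ ⟩
    (x - y) + y      ≈⟨ +-assoc x (- y) y ⟩
    x + (- y + y)    ≈⟨ +-congˡ (-‿inverseˡ y) ⟩
    x + 0#           ≈⟨ +-identityʳ x ⟩
    x                ∎)

  ≈⇒≡mod : ∀ {x y q m} → x ≈ y + q * m → _≡_mod_ R x y m
  ≈⇒≡mod {x} {y} {q} {m} x≈y+qm = q , sym (begin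
    x - y              ≈⟨ +-congʳ x≈y+qm ⟩
    (y + q * m) - y    ≈⟨ +-congʳ (+-comm y _) ⟩
    (q * m + y) - y    ≈⟨ +-assoc _ y (- y) ⟩
    q * m + (y - y)    ≈⟨ +-congˡ (-‿inverseʳ y) ⟩
    q * m + 0#         ≈⟨ +-identityʳ _ ⟩
    q * m              ∎)

  ≡mod-∣ : ∀ {x y m n} → n ∣ m → _≡_mod_ R x y m → _≡_mod_ R x y n
  ≡mod-∣ n∣m m∣x-y = ∣ʳ-trans n∣m m∣x-y

  ≡mod-respʳ : ∀ {x y z m} → y ≈ z → _≡_mod_ R x y m → _≡_mod_ R x z m
  ≡mod-respʳ y≈z x≡y with ≡mod⇒≈ x≡y
  ... | q , x≈y+qm = ≈⇒≡mod (trans x≈y+qm (+-congʳ y≈z))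

  nzd-cancelˡ : ∀ {r x y} → NonZeroDivisor R r → r * x ≈ r * y → x ≈ y
  nzd-cancelˡ {r} {x} {y} r-nzd rx≈ry = begin
    x                ≈⟨ sym (+-identityʳ x) ⟩
    x + 0#           ≈⟨ +-congˡ (sym (-‿inverseˡ y)) ⟩
    x + (- y + y)    ≈⟨ sym (+-assoc x (- y) y) ⟩
    (x - y) + y      ≈⟨ +-congʳ (r-nzd (x - y) r[x-y]≈0) ⟩
    0# + y           ≈⟨ +-identityˡ y ⟩
    y                ∎
    where
    open import Algebra.Properties.Ring ring using (-‿distribʳ-*)
    r[x-y]≈0 : r * (x - y) ≈ 0#
    r[x-y]≈0 = begin
      r * (x - y)        ≈⟨ distribˡ r x (- y) ⟩
      r * x + r * - y    ≈⟨ +-cong rx≈ry (sym (-‿distribʳ-* r y)) ⟩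
      r * y - r * y      ≈⟨ -‿inverseʳ (r * y) ⟩
      0#                 ∎

module Lucasian {c ℓ} (R : CommutativeRing c ℓ) (s : ℕ → CommutativeRing.Carrier R)
                (s0≈0 : CommutativeRing._≈_ R (s 0) (CommutativeRing.0# R))
                (lucas : IsLucasian R s) where
  open CommutativeRing R
  open import Algebra.Definitions.RawSemiring (Semiring.rawSemiring semiring)
    using (_∣_) renaming (_×_ to _·ℕ_)
  open import Algebra.Definitions.RawMagma *-rawMagma using (_,_)
  open import Algebra.Properties.Semiring.Divisibility semiring
    using (∣ʳ-reflexive; x∣ʳy⇒xz∣ʳyz)
  open import Algebra.Properties.Semiring.Mult semiring using (×-congʳ)
  open import Algebra.Solver.Ring.NaturalCoefficients.Default commutativeSemiring
  open import Relation.Binary.Reasoning.Setoid setoid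
  open Congruence R

  ∣⇒s∣s : ∀ {a b} → a ℕD.∣ b → s a ∣ s b
  ∣⇒s∣s {a} (divides t P.refl) = s[a]∣s[t*a] t
    where
    s[a]∣s[t*a] : ∀ t → s a ∣ s (t ℕ.* a)
    s[a]∣s[t*a] zero = 0# , trans (zeroˡ (s a)) (sym s0≈0)
    s[a]∣s[t*a] (suc t) with ≡mod⇒≈ (lucas a (t ℕ.* a)) | s[a]∣s[t*a] t
    ... | q , lucas-step | r , rsa≈s[ta] = 1# + r + q * s a * r , (begin
      (1# + r + q * s a * r) * s a
        ≈⟨ solve 3 (λ sa r q → (con 1 :+ r :+ q :* sa :* r) :* sa
                             := (sa :+ r :* sa) :+ q :* (sa :* (r :* sa))) refl (s a) r q ⟩
      (s a + r * s a) + q * (s a * (r * s a))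
        ≈⟨ +-cong (+-congˡ rsa≈s[ta]) (*-congˡ (*-congˡ rsa≈s[ta])) ⟩
      (s a + s (t ℕ.* a)) + q * (s a * s (t ℕ.* a))
        ≈⟨ sym lucas-step ⟩
      s (a ℕ.+ t ℕ.* a)  ∎)

  s[t*a]≡t×s[a] : ∀ t a → _≡_mod_ R (s (t ℕ.* a)) (t ·ℕ s a) (s a * s a)
  s[t*a]≡t×s[a] zero a = ≈⇒≡mod (begin
    s 0                       ≈⟨ s0≈0 ⟩
    0#                        ≈⟨ sym (+-identityʳ 0#) ⟩
    0# + 0#                   ≈⟨ +-congˡ (sym (zeroˡ _)) ⟩
    0# + 0# * (s a * s a)     ∎)
  s[t*a]≡t×s[a] (suc t) a
    with ≡mod⇒≈ (lucas a (t ℕ.* a)) | ∣⇒s∣s (ℕD.n∣m*n t {a}) | ≡mod⇒≈ (s[t*a]≡t×s[a] t a)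
  ... | q , lucas-step | r , rsa≈s[ta] | q′ , s[ta]≈ = ≈⇒≡mod (begin
    s (a ℕ.+ t ℕ.* a)
      ≈⟨ lucas-step ⟩
    (s a + s (t ℕ.* a)) + q * (s a * s (t ℕ.* a))
      ≈⟨ +-cong (+-congˡ s[ta]≈) (*-congˡ (*-congˡ (sym rsa≈s[ta]))) ⟩
    (s a + (t ·ℕ s a + q′ * (s a * s a))) + q * (s a * (r * s a))
      ≈⟨ solve 5 (λ sa T q q′ r → (sa :+ (T :+ q′ :* (sa :* sa))) :+ q :* (sa :* (r :* sa))
                               := (sa :+ T) :+ (q′ :+ q :* r) :* (sa :* sa))
               refl (s a) (t ·ℕ s a) q q′ r ⟩
    (s a + t ·ℕ s a) + (q′ + q * r) * (s a * s a)  ∎)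

  GreenAt : ℕ → ℕ → ℕ → Set (c ⊔ ℓ)
  GreenAt m a b = ∀ Q → s a * s b ≈ s (gcd a b) * Q →
                  ∀ k → m ≡ k ℕ.* lcm a b →
                  _≡_mod_ R (s m) (k ·ℕ Q) (s a * s b)

  GreenAt-sym : ∀ {m a b} → GreenAt m a b → GreenAt m b a
  GreenAt-sym {a = a} {b} green Q eQ k m≡k*lcm =
    ≡mod-∣ (∣ʳ-reflexive (*-comm (s b) (s a)))
      (green Q (trans (*-comm (s a) (s b)) (P.subst (λ g → s b * s a ≈ s g * Q) (gcd-comm b a) eQ))
             k (P.trans m≡k*lcm (P.cong (k ℕ.*_) (lcm-comm b a))))

  GreenAt-∣ : ∀ {m a b} → NonZeroDivisor R (s a) → a ℕD.∣ b → GreenAt m a b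
  GreenAt-∣ {a = a} {b} sa-nzd a∣b Q eQ k P.refl rewrite m∣n⇒lcm[m,n]≡n a∣b =
    ≡mod-respʳ (×-congʳ k sb≈Q)
      (≡mod-∣ (x∣ʳy⇒xz∣ʳyz (s b) (∣⇒s∣s a∣b)) (s[t*a]≡t×s[a] k b))
    where
    sb≈Q : s b ≈ Q
    sb≈Q = nzd-cancelˡ sa-nzd (P.subst (λ g → s a * s b ≈ s g * Q) (m∣n⇒gcd[m,n]≡m a∣b) eQ)

mainTheorem10 : ∀ {c ℓ} (R : CommutativeRing c ℓ) (s : ℕ → CommutativeRing.Carrier R) →
                  IsGNS R s → IsLucasian R s → IsGreen R PrimePower s
mainTheorem10 R s gns lucas m (p , e , p-prime , P.refl) a b 0<a 0<b a∣m b∣m =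
  [ GreenAt-∣ (nzd a 0<a) , GreenAt-sym ∘ GreenAt-∣ (nzd b 0<b) ]′
    (∣p^e-total {e = e} p-prime a∣m b∣m)
  where
  open IsGNS gns
  open Lucasian R s zero-at-0 lucas
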